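{- Every connected un2qBMG $(G,\sigma)$ has a heart-vertex, i.e., a vertex $x$ adjacent to every vertex $y$ of $G$ with $\sigma(y)\neq\sigma(x)$.
   Context: A truncation map $u$ on a rooted phylogenetic tree $T$ (root $\rho$, leaf set $L(T)$, every internal vertex has at least two children) with leaf-coloring $\sigma$ into two colors assigns to each leaf $x$ a vertex $u(x)$ on the path from $\rho$ to $x$. A leaf $y$ is a quasi-best match of a leaf $x$ if $\sigma(y)\ne\sigma(x)$, $\mathrm{lca}(x,y)$ is a descendant of (or equal to) $\mathrm{lca}(x,z)$ for every leaf $z$ with $\sigma(z)=\sigma(y)$, and $\mathrm{lca}(x,y)$ is a descendant of (or equal to) $u(x)$. The 2qBMG of $(T,\sigma,u)$ is the digraph on $L(T)$ with arcs $x\to y$ for quasi-best matches. A vertex-colored graph $(G,\sigma)$ is a un2qBMG if it is the underlying undirected graph of the 2qBMG of some $(T,\sigma,u)$ with $L(T)=V(G)$. -}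

module Defs where

open import Data.Nat using (ℕ; suc)
open import Data.Fin using (Fin; _≟_)
open import Data.Vec using (Vec; lookup)
open import Data.Bool using (Bool)
open import Data.Product using (Σ; ∃; _×_; _,_)
open import Data.Sum using (_⊎_)
open import Relation.Nullary using (¬_; yes; no)
open import Relation.Binary.PropositionalEquality using (_≡_; _≢_; refl)
open import Relation.Binary.Construct.Closure.ReflexiveTransitive using (Star)
open import Function.Bundles using (_⇔_)

data Tree (n : ℕ) : Set where
  leaf : Fin n → Tree n
  node : ∀ {k} → Vec (Tree n) (suc (suc k)) → Tree n

-- Vertices of a tree, given by their (unique) path from the root.
data Pos {n : ℕ} : Tree n → Set where
  root  : ∀ {t} → Pos t
  child : ∀ {k} {cs : Vec (Tree n) (suc (suc k))}
          (i : Fin (suc (suc k))) → Pos (lookup cs i) → Pos (node cs)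

-- p ⊑ q : p is an ancestor of q or equal to it
-- (equivalently: q is a descendant of, or equal to, p).
data _⊑_ {n : ℕ} : {t : Tree n} → Pos t → Pos t → Set where
  root⊑  : ∀ {t} {q : Pos t} → root ⊑ q
  child⊑ : ∀ {k} {cs : Vec (Tree n) (suc (suc k))} {i : Fin (suc (suc k))}
           {p q : Pos (lookup cs i)} → p ⊑ q → child {cs = cs} i p ⊑ child i q

data LeafAt {n : ℕ} : {t : Tree n} → Pos t → Fin n → Set where
  here  : ∀ {x} → LeafAt {t = leaf x} root x
  there : ∀ {k} {cs : Vec (Tree n) (suc (suc k))} {i : Fin (suc (suc k))}
          {p : Pos (lookup cs i)} {x} → LeafAt p x → LeafAt (child {cs = cs} i p) x

lca : ∀ {n} {t : Tree n} → Pos t → Pos t → Pos t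
lca root q = root
lca (child i p) root = root
lca (child i p) (child j q) with i ≟ j
... | yes refl = child i (lca p q)
... | no _ = root

-- A phylogenetic tree with leaf set L(T) = Fin n: every label x ∈ Fin n
-- occurs at exactly one leaf (every leaf carries a label by construction).
record PhyloTree (n : ℕ) : Set where
  field
    tree      : Tree n
    leafPos   : Fin n → Pos tree
    leafPosOk : ∀ x → LeafAt (leafPos x) x
    leafPosUnique : ∀ {x} (p : Pos tree) → LeafAt p x → p ≡ leafPos x
open PhyloTree public

record Truncation {n : ℕ} (T : PhyloTree n) : Set where
  field
    u    : Fin n → Pos (tree T)
    u⊑x : ∀ x → u x ⊑ leafPos T x
open Truncation public

QuasiBestMatch : ∀ {n} (T : PhyloTree n) (σ : Fin n → Bool) (U : Truncation T)
                 → Fin n → Fin n → Set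
QuasiBestMatch T σ U x y =
  (σ y ≢ σ x)
  × (∀ z → σ z ≡ σ y → lca (leafPos T x) (leafPos T z) ⊑ lca (leafPos T x) (leafPos T y))
  × (u U x ⊑ lca (leafPos T x) (leafPos T y))

record Graph (n : ℕ) : Set₁ where
  field
    Adj     : Fin n → Fin n → Set
    symAdj  : ∀ {x y} → Adj x y → Adj y x
    irrAdj  : ∀ {x} → ¬ Adj x x
open Graph public

-- (G, σ) is the underlying undirected graph of the 2qBMG of some (T, σ, u)
-- with L(T) = V(G).
IsUn2qBMG : ∀ {n} → Graph n → (Fin n → Bool) → Set
IsUn2qBMG {n} G σ =
  Σ (PhyloTree n) λ T → Σ (Truncation T) λ U →
    ∀ x y → Adj G x y ⇔ (QuasiBestMatch T σ U x y ⊎ QuasiBestMatch T σ U y x)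

Connected : ∀ {n} → Graph n → Set
Connected {n} G = ∀ (x y : Fin n) → Star (Adj G) x y

HeartVertex : ∀ {n} → Graph n → (Fin n → Bool) → Fin n → Set
HeartVertex G σ x = ∀ y → σ y ≢ σ x → Adj G x y

-- A single-leaf tree is trivial. Otherwise the leaves lie below at least two
-- children of the root, so by connectivity some edge x — y joins leaves in
-- different subtrees of the root, i.e. lca(x, y) = ρ. That edge is a quasi-best
-- match, say x → y. Then u(x) = ρ and every leaf z of colour σ(y) satisfies
-- lca(x, z) = ρ, so with only two colours every leaf w of colour ≠ σ(x) is a
-- quasi-best match of x: x is a heart-vertex.
module Submission where

open import Defs
open import Data.Nat using (ℕ; suc)
open import Data.Fin using (Fin; zero; suc; _≟_)
open import Data.Bool using (Bool)
open import Data.Bool.Properties using (¬-not)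
open import Data.Product using (Σ; ∃; _×_; _,_)
open import Data.Sum using (_⊎_; inj₁; inj₂)
open import Data.Maybe using (Maybe; just; nothing)
open import Data.Maybe.Properties using (≡-dec)
open import Data.Vec using (Vec; _∷_)
open import Data.Empty using (⊥-elim)
open import Relation.Nullary using (yes; no)
open import Relation.Binary.Definitions using (DecidableEquality)
open import Relation.Binary.PropositionalEquality
  using (_≡_; _≢_; refl; sym; trans; cong; subst)
open import Relation.Binary.Construct.Closure.ReflexiveTransitive using (Star; ε; _◅_)
open import Function.Bundles using (_⇔_; Equivalence)

twoColours : ∀ {a b c : Bool} → a ≢ c → b ≢ c → a ≡ b
twoColours a≢c b≢c = trans (¬-not a≢c) (sym (¬-not b≢c))

Star⇒edgeChanging : ∀ {A B : Set} {R : A → A → Set} (f : A → B) → DecidableEquality B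
                  → ∀ {a b} → Star R a b → f a ≢ f b
                  → Σ A λ x → Σ A λ y → R x y × f x ≢ f y
Star⇒edgeChanging f _≟B_ ε fa≢fb = ⊥-elim (fa≢fb refl)
Star⇒edgeChanging f _≟B_ {a} (_◅_ {j = c} r c⋆b) fa≢fb with f a ≟B f c
... | no fa≢fc = a , c , r , fa≢fc
... | yes fa≡fc = Star⇒edgeChanging f _≟B_ c⋆b (λ fc≡fb → fa≢fb (trans fa≡fc fc≡fb))

⊑root⇒⊑ : ∀ {n} {t : Tree n} {p q : Pos t} → p ⊑ root → p ⊑ q
⊑root⇒⊑ root⊑ = root⊑

leafAt-leaf : ∀ {n} {a x : Fin n} {p : Pos (leaf a)} → LeafAt p x → x ≡ a
leafAt-leaf here = refl

someLeaf : ∀ {n} (t : Tree n) → Σ (Pos t) λ p → ∃ λ x → LeafAt p x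
someLeaf (leaf x) = root , x , here
someLeaf (node (c ∷ _)) with someLeaf c
... | p , x , p↦x = child zero p , x , there p↦x

rootChild : ∀ {n k} {cs : Vec (Tree n) (suc (suc k))} → Pos (node cs) → Maybe (Fin (suc (suc k)))
rootChild root        = nothing
rootChild (child i _) = just i

lca≡root : ∀ {n k} {cs : Vec (Tree n) (suc (suc k))} (p q : Pos (node cs))
         → rootChild p ≢ rootChild q → lca p q ≡ root
lca≡root root        q           _  = refl
lca≡root (child i p) root        _  = refl
lca≡root (child i p) (child j q) i≢j with i ≟ j
... | yes refl = ⊥-elim (i≢j refl)
... | no _     = refl

singleLeaf⊎edgeThroughRoot
  : ∀ {n} (t : Tree n) (pos : Fin n → Pos t)
  → (∀ x → LeafAt (pos x) x) → (∀ {x} (p : Pos t) → LeafAt p x → p ≡ pos x)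
  → (R : Fin n → Fin n → Set) → (∀ x y → Star R x y)
  → (Σ (Fin n) λ a → ∀ x → x ≡ a)
  ⊎ (Σ (Fin n) λ x → Σ (Fin n) λ y →
       R x y × lca (pos x) (pos y) ≡ root × lca (pos y) (pos x) ≡ root)
singleLeaf⊎edgeThroughRoot (leaf a) pos pos↦ _ _ _ =
  inj₁ (a , λ x → leafAt-leaf (pos↦ x))
singleLeaf⊎edgeThroughRoot (node (c ∷ d ∷ _)) pos _ posUnique R connected
  with someLeaf c | someLeaf d
... | p , a , p↦a | q , b , q↦b
  with Star⇒edgeChanging (λ x → rootChild (pos x)) (≡-dec _≟_) (connected a b) a≢b
  where
  a≢b : rootChild (pos a) ≢ rootChild (pos b)
  a≢b eq with trans (cong rootChild (posUnique (child zero p) (there p↦a)))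
                    (trans eq (cong rootChild (sym (posUnique (child (suc zero) q) (there q↦b)))))
  ... | ()
... | x , y , xRy , x≢y =
  inj₂ (x , y , xRy , lca≡root (pos x) (pos y) x≢y , lca≡root (pos y) (pos x) (λ eq → x≢y (sym eq)))

module _ {n} (T : PhyloTree n) (σ : Fin n → Bool) (U : Truncation T) where

  matchThroughRoot⇒matchesOtherColour
    : ∀ {x y} → QuasiBestMatch T σ U x y → lca (leafPos T x) (leafPos T y) ≡ root
    → ∀ w → σ w ≢ σ x → QuasiBestMatch T σ U x w
  matchThroughRoot⇒matchesOtherColour {x} (σy≢σx , best , u⊑) lca≡ρ w σw≢σx =
    σw≢σx , best′ , ⊑root⇒⊑ (subst (_ ⊑_) lca≡ρ u⊑)
    where
    best′ : ∀ z → σ z ≡ σ w → lca (leafPos T x) (leafPos T z) ⊑ lca (leafPos T x) (leafPos T w)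
    best′ z σz≡σw =
      ⊑root⇒⊑ (subst (_ ⊑_) lca≡ρ (best z (trans σz≡σw (twoColours σw≢σx σy≢σx))))

  matchThroughRoot⇒heart
    : (G : Graph n) → (∀ x y → Adj G x y ⇔ (QuasiBestMatch T σ U x y ⊎ QuasiBestMatch T σ U y x))
    → ∀ {x y} → QuasiBestMatch T σ U x y → lca (leafPos T x) (leafPos T y) ≡ root
    → HeartVertex G σ x
  matchThroughRoot⇒heart G adj⇔match {x} x→y lca≡ρ w σw≢σx =
    Equivalence.from (adj⇔match x w) (inj₁ (matchThroughRoot⇒matchesOtherColour x→y lca≡ρ w σw≢σx))

lemma5p2 : ∀ (n : ℕ) (G : Graph n) (σ : Fin n → Bool)
           → IsUn2qBMG G σ → Connected G → ∃ λ x → HeartVertex G σ x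
lemma5p2 n G σ (T , U , adj⇔match) connected
  with singleLeaf⊎edgeThroughRoot (tree T) (leafPos T) (leafPosOk T) (leafPosUnique T)
                                  (Adj G) connected
... | inj₁ (a , onlyA) = a , λ y σy≢σa → ⊥-elim (σy≢σa (cong σ (onlyA y)))
... | inj₂ (x , y , xy , lca-xy≡ρ , lca-yx≡ρ) with Equivalence.to (adj⇔match x y) xy
...   | inj₁ x→y = x , matchThroughRoot⇒heart T σ U G adj⇔match x→y lca-xy≡ρ
...   | inj₂ y→x = y , matchThroughRoot⇒heart T σ U G adj⇔match y→x lca-yx≡ρ
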